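{- The $G$-flow $\mathcal{LO}(M_1)$ is not minimal, i.e. it contains a proper subflow (non-empty closed $G$-invariant proper subset), where $G=\mathrm{Aut}(M_1)$.
   Context: Graphs are simple and "subgraph" means induced subgraph. A $2$-orientation of a graph is an orientation in which every vertex has out-degree at most $2$; it is acyclic if there is no directed cycle. Let $\mathcal{C}_1$ be the class of finite graphs admitting an acyclic $2$-orientation. For an oriented graph $A$, a subset $B\subseteq A$ is successor-closed if every out-neighbour in $A$ of a vertex of $B$ lies in $B$. For $A\subseteq B$ in $\mathcal{C}_1$, write $A\le_1 B$ if there is an acyclic $2$-orientation of $B$ in which $A$ is successor-closed. $M_1$ is the Fraïssé limit of the free amalgamation class $(\mathcal{C}_1,\le_1)$: the unique countable graph which is the union of a chain $A_0\le_1A_1\le_1\cdots$ in $\mathcal{C}_1$ (finite $A\subseteq M_1$ satisfies $A\le_1 M_1$ if $A\le_1 A_n$ for some $n$ with $A\subseteq A_n$), into which every graph of $\mathcal{C}_1$ $\le_1$-embeds, and in which every isomorphism between finite $\le_1$-subgraphs extends to an automorphism. $\mathcal{LO}(M_1)$ is the space of linear orders on $M_1$ with the pointwise-convergence topology and the action $x\,(g\cdot\prec)\,y\iff g^{ -1}x\prec g^{ -1}y$ of $G=\mathrm{Aut}(M_1)$. -}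

module Defs where

open import Data.Bool using (Bool; true; false)
open import Data.Nat using (ℕ; suc; _≤_)
open import Data.Fin using (Fin)
open import Data.List using (List; length; filterᵇ; map; allFin)
open import Data.List.Membership.Propositional using (_∈_)
open import Data.List.Relation.Binary.Subset.Propositional using (_⊆_)
open import Data.List.Relation.Unary.Unique.Propositional using (Unique)
open import Data.Product using (Σ; ∃; _×_)
open import Data.Sum using (_⊎_)
open import Function.Definitions using (Injective)
open import Relation.Nullary using (¬_)
open import Relation.Binary.PropositionalEquality using (_≡_; _≢_)
open import Relation.Binary.Construct.Closure.Transitive using (TransClosure)

BRel : Set → Set
BRel V = V → V → Bool

-- O is an acyclic 2-orientation of the subgraph of (V, adj) induced on the
-- finite vertex set S (S is assumed duplicate-free wherever this is used).
-- O x y ≡ true means the edge xy is oriented x → y.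
record IsAcyclic2Orientation {V : Set} (adj : BRel V) (S : List V) (O : BRel V) : Set where
  field
    onEdges : ∀ x y → O x y ≡ true → (x ∈ S) × (y ∈ S) × (adj x y ≡ true)
    orients : ∀ x y → x ∈ S → y ∈ S → adj x y ≡ true →
              ((O x y ≡ true) × (O y x ≡ false)) ⊎ ((O x y ≡ false) × (O y x ≡ true))
    outdeg  : ∀ x → x ∈ S → length (filterᵇ (O x) S) ≤ 2
    acyclic : ∀ x → ¬ TransClosure (λ a b → O a b ≡ true) x x

InC1 : {V : Set} → BRel V → List V → Set
InC1 adj S = ∃ λ O → IsAcyclic2Orientation adj S O

Le1 : {V : Set} → BRel V → List V → List V → Set
Le1 adj A B = (A ⊆ B) × (∃ λ O → IsAcyclic2Orientation adj B O ×
                                  (∀ x y → x ∈ A → O x y ≡ true → y ∈ A))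

record FinGraph : Set where
  field
    size   : ℕ
    adj    : BRel (Fin size)
    sym    : ∀ x y → adj x y ≡ adj y x
    irrefl : ∀ x → adj x x ≡ false

record ChainGraph : Set where
  field
    adj          : BRel ℕ
    sym          : ∀ x y → adj x y ≡ adj y x
    irrefl       : ∀ x → adj x x ≡ false
    chain        : ℕ → List ℕ
    chain-unique : ∀ n → Unique (chain n)
    chain-C1     : ∀ n → InC1 adj (chain n)
    chain-≤      : ∀ n → Le1 adj (chain n) (chain (suc n))
    chain-covers : ∀ v → ∃ λ n → v ∈ chain n

module _ (M : ChainGraph) where
  open ChainGraph M

  LeM : List ℕ → Set
  LeM A = ∃ λ n → Le1 adj A (chain n)

  record Aut : Set where
    field
      to      : ℕ → ℕ
      from    : ℕ → ℕ
      to-from : ∀ x → to (from x) ≡ x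
      from-to : ∀ x → from (to x) ≡ x
      pres    : ∀ x y → adj (to x) (to y) ≡ adj x y

  Universal : Set
  Universal = (H : FinGraph) → InC1 (FinGraph.adj H) (allFin (FinGraph.size H)) →
    Σ (Fin (FinGraph.size H) → ℕ) λ f →
      Injective _≡_ _≡_ f ×
      (∀ i j → adj (f i) (f j) ≡ FinGraph.adj H i j) ×
      LeM (map f (allFin (FinGraph.size H)))

  Homogeneous : Set
  Homogeneous = (A : List ℕ) (f : ℕ → ℕ) → Unique A → Unique (map f A) →
    (∀ x y → x ∈ A → y ∈ A → adj (f x) (f y) ≡ adj x y) →
    LeM A → LeM (map f A) →
    Σ Aut λ g → ∀ x → x ∈ A → Aut.to g x ≡ f x

  -- M is (a copy of) the Fraïssé limit M₁
  IsM1 : Set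
  IsM1 = Universal × Homogeneous

  record IsLO (R : BRel ℕ) : Set where
    field
      irrefl : ∀ x → R x x ≡ false
      trans  : ∀ x y z → R x y ≡ true → R y z ≡ true → R x z ≡ true
      total  : ∀ x y → x ≢ y → (R x y ≡ true) ⊎ (R y x ≡ true)

  act : Aut → BRel ℕ → BRel ℕ
  act g R x y = R (Aut.from g x) (Aut.from g y)

  -- S is a subflow of LO(M): non-empty, G-invariant, closed in the
  -- pointwise-convergence topology (every order approximable on each finite
  -- set by members of S belongs to S)
  IsSubflow : (BRel ℕ → Set) → Set
  IsSubflow S =
    (∀ R → S R → IsLO R) ×
    (∃ λ R → S R) ×
    (∀ g R → S R → S (act g R)) ×
    (∀ R → IsLO R →
       (∀ (F : List ℕ) → ∃ λ R' → S R' × (∀ x y → x ∈ F → y ∈ F → R' x y ≡ R x y)) →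
       S R)

  LONotMinimal : Set₁
  LONotMinimal = Σ (BRel ℕ → Set) λ S → IsSubflow S × (∃ λ R → IsLO R × ¬ S R)

-- Call a linear order on M 2-degenerate if every vertex has at most two smaller
-- neighbours. This is a condition on four points at a time, so the 2-degenerate
-- orders form a closed Aut(M)-invariant set. It is non-empty: order M first by the
-- stage of the chain A₀ ≤₁ A₁ ≤₁ ⋯ at which a vertex appears and then, within a
-- stage s, by height in an acyclic 2-orientation of Aₛ in which Aₛ₋₁ is
-- successor-closed. A smaller neighbour y of x is then an out-neighbour of x: if y
-- is older, an arc y → x would leave Aₛ₋₁; if y is as new as x, heights decrease
-- along arcs. The set is proper: M contains the star K₁,₃, and an order putting
-- its centre last gives the centre three smaller neighbours.
module Submission where

open import Defs
open import Level using (0ℓ)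
open import Data.Bool using (true; false; T?; if_then_else_)
open import Data.Bool.Properties using (T-≡)
open import Data.Empty using (⊥-elim)
open import Data.Fin using (Fin) renaming (zero to fzero; suc to fsuc)
import Data.Fin.Properties as Fin
open import Data.Nat using (ℕ; zero; suc; _≤_; _<_; z≤n; s≤s; _≤′_; ≤′-refl; ≤′-step)
open import Data.Nat.Properties
  using (_≟_; <-strictTotalOrder; ≤-refl; ≤-trans; <⇒≤; ≤-pred; ≤⇒≤′; <-irrefl; <-≤-trans; module ≤-Reasoning)
open import Data.List using (List; []; _∷_; length; map; filterᵇ; tabulate; allFin)
open import Data.List.Properties using (length-map; length-removeAt′)
open import Data.List.Extrema.Nat using (max; argmax-sel; v≤max⁺)
open import Data.List.Membership.Propositional using (_∈_; _∉_; lose)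
open import Data.List.Membership.Propositional.Properties using (∈-map⁺; ∈-map⁻; ∈-filter⁺; ∈-filter⁻; ∈-allFin)
open import Data.List.Membership.DecPropositional _≟_ using (_∈?_)
open import Data.List.Relation.Binary.Subset.Propositional using (_⊆_)
open import Data.List.Relation.Unary.All as All using (All; []; _∷_)
import Data.List.Relation.Unary.All.Properties as All
open import Data.List.Relation.Unary.AllPairs as AllPairs using ([]; _∷_)
open import Data.List.Relation.Unary.Any using (here; there; _─_)
open import Data.List.Relation.Unary.Linked as Linked using (Linked; [-]; _∷_)
open import Data.List.Relation.Unary.Linked.Properties using (Linked⇒AllPairs)
open import Data.List.Relation.Unary.Unique.Propositional using (Unique)
import Data.List.Relation.Unary.Unique.Propositional.Properties as Unique
open import Data.Product using (∃; _×_; _,_; proj₁; proj₂)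
open import Data.Product.Relation.Binary.Lex.Strict using (×-Lex; ×-strictTotalOrder)
open import Data.Sum using (_⊎_; inj₁; inj₂)
open import Data.Unit using (⊤; tt)
open import Function using (_∘_; id)
open import Function.Bundles using (Equivalence)
open import Relation.Binary.Bundles using (StrictTotalOrder)
open import Relation.Binary.Definitions using (Tri; tri<; tri≈; tri>)
open import Relation.Binary.PropositionalEquality using (_≡_; _≢_; refl; sym; trans; cong; cong₂; subst)
open import Relation.Binary.Construct.Closure.Transitive using (TransClosure; [_]; _∷_; _++_)
open import Relation.Nullary using (¬_; yes; no; does)
open import Relation.Nullary.Decidable using (dec-true; dec-false)

∈-─⁺ : ∀ {A : Set} {x z : A} {ys} (x∈ys : x ∈ ys) → z ∈ ys → z ≢ x → z ∈ (ys ─ x∈ys)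
∈-─⁺ (here refl)  (here refl)  z≢x = ⊥-elim (z≢x refl)
∈-─⁺ (here _)     (there z∈ys) _   = z∈ys
∈-─⁺ (there _)    (here refl)  _   = here refl
∈-─⁺ (there x∈ys) (there z∈ys) z≢x = there (∈-─⁺ x∈ys z∈ys z≢x)

Unique⇒length-≤ : ∀ {A : Set} {xs ys : List A} → Unique xs → xs ⊆ ys → length xs ≤ length ys
Unique⇒length-≤ {xs = []}     _            _     = z≤n
Unique⇒length-≤ {xs = x ∷ xs} {ys} (x∉xs ∷ u) xs⊆ys = begin
  suc (length xs)          ≤⟨ s≤s (Unique⇒length-≤ u xs⊆ys─x) ⟩
  suc (length (ys ─ x∈ys)) ≡⟨ sym (length-removeAt′ ys _) ⟩
  length ys                ∎
  where
  open ≤-Reasoning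
  x∈ys : x ∈ ys
  x∈ys = xs⊆ys (here refl)
  xs⊆ys─x : xs ⊆ (ys ─ x∈ys)
  xs⊆ys─x z∈xs = ∈-─⁺ x∈ys (xs⊆ys (there z∈xs)) (λ z≡x → All.lookup x∉xs z∈xs (sym z≡x))

module Heights {V : Set} (S : List V) (O : BRel V) where

  Arc : V → V → Set
  Arc x y = O x y ≡ true

  successors : V → List V
  successors y = filterᵇ (O y) S

  ∈-successors⁺ : ∀ {y z} → z ∈ S → Arc y z → z ∈ successors y
  ∈-successors⁺ {y} z∈S yz = ∈-filter⁺ (T? ∘ O y) z∈S (Equivalence.from T-≡ yz)

  ∈-successors⁻ : ∀ {y z} → z ∈ successors y → z ∈ S × Arc y z
  ∈-successors⁻ {y} z∈ with ∈-filter⁻ (T? ∘ O y) z∈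
  ... | z∈S , yz = z∈S , Equivalence.to T-≡ yz

  Walk : V → List V → Set
  Walk y zs = All (_∈ S) zs × Linked Arc (y ∷ zs)

  height : ℕ → V → ℕ
  height zero    y = 0
  height (suc k) y = max 0 (map (suc ∘ height k) (successors y))

  rank : V → ℕ
  rank = height (length S)

  walk-of-height : ∀ k y → ∃ λ zs → length zs ≡ height k y × Walk y zs
  walk-of-height zero    y = [] , refl , [] , [-]
  walk-of-height (suc k) y with argmax-sel id 0 (map (suc ∘ height k) (successors y))
  ... | inj₁ height≡0 = [] , sym height≡0 , [] , [-]
  ... | inj₂ height∈ with ∈-map⁻ (suc ∘ height k) height∈
  ... | z , z∈ , height≡ with ∈-successors⁻ z∈ | walk-of-height k z
  ... | z∈S , yz | zs , length≡ , zs⊆S , linked =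
    z ∷ zs , trans (cong suc length≡) (sym height≡) , z∈S ∷ zs⊆S , yz ∷ linked

  height-of-walk : ∀ k {y zs} → Walk y zs → length zs ≤ k → length zs ≤ height k y
  height-of-walk k       {zs = []}     _ _ = z≤n
  height-of-walk (suc k) {zs = z ∷ zs} (z∈S ∷ zs⊆S , yz ∷ linked) (s≤s length≤k) =
    v≤max⁺ 0 _ (inj₂ (lose (∈-map⁺ (suc ∘ height k) (∈-successors⁺ z∈S yz))
                           (s≤s (height-of-walk k (zs⊆S , linked) length≤k))))

  module _ (acyclic : ∀ x → ¬ TransClosure Arc x x) where

    walk-unique : ∀ {xs} → Linked Arc xs → Unique xs
    walk-unique = AllPairs.map (λ { x⁺x refl → acyclic _ x⁺x }) ∘ Linked⇒AllPairs _++_ ∘ Linked.map [_]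

    height<length : ∀ k {y} → y ∈ S → height k y < length S
    height<length k {y} y∈S with walk-of-height k y
    ... | zs , length≡ , zs⊆S , linked =
      subst (λ m → suc m ≤ length S) length≡
        (Unique⇒length-≤ (walk-unique linked) λ { (here refl) → y∈S ; (there z∈) → All.lookup zs⊆S z∈ })

    rank-decreasing : ∀ {y z} → z ∈ S → Arc y z → rank z < rank y
    rank-decreasing {y} {z} z∈S yz with walk-of-height (length S) z
    ... | zs , length≡ , zs⊆S , linked =
      subst (_< rank y) length≡
        (height-of-walk (length S) (z∈S ∷ zs⊆S , yz ∷ linked)
          (subst (_< length S) (sym length≡) (height<length (length S) z∈S)))

arc-of-¬reverse : ∀ {V : Set} {adj : BRel V} {S O} → IsAcyclic2Orientation adj S O →
                  ∀ {x y} → x ∈ S → y ∈ S → adj x y ≡ true → O y x ≢ true → O x y ≡ true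
arc-of-¬reverse orientation x∈S y∈S xy ¬yx with IsAcyclic2Orientation.orients orientation _ _ x∈S y∈S xy
... | inj₁ (arc , _) = arc
... | inj₂ (_ , yx)  = ⊥-elim (¬yx yx)

module _ (M : ChainGraph) (K : StrictTotalOrder 0ℓ 0ℓ 0ℓ) where
  open StrictTotalOrder K using (Carrier; _≈_; compare)
    renaming (_<_ to _⊏_; _<?_ to _⊏?_; irrefl to ⊏-irrefl; trans to ⊏-trans)
  private module ≈ = StrictTotalOrder.Eq K

  orderBy : (ℕ → Carrier) → BRel ℕ
  orderBy key x y = does (key x ⊏? key y)

  orderBy⇒⊏ : ∀ key {x y} → orderBy key x y ≡ true → key x ⊏ key y
  orderBy⇒⊏ key {x} {y} x≺y with key x ⊏? key y
  orderBy⇒⊏ key {x} {y} refl | yes kx⊏ky = kx⊏ky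

  orderBy-isLO : ∀ key → (∀ x y → key x ≈ key y → x ≡ y) → IsLO M (orderBy key)
  orderBy-isLO key injective = record
    { irrefl = λ x → dec-false (key x ⊏? key x) (⊏-irrefl ≈.refl)
    ; trans  = λ x y z x≺y y≺z → dec-true (key x ⊏? key z)
                 (⊏-trans (orderBy⇒⊏ key x≺y) (orderBy⇒⊏ key y≺z))
    ; total  = total
    }
    where
    total : ∀ x y → x ≢ y → (orderBy key x y ≡ true) ⊎ (orderBy key y x ≡ true)
    total x y x≢y = by-trichotomy (compare (key x) (key y))
      where
      by-trichotomy : Tri (key x ⊏ key y) (key x ≈ key y) (key y ⊏ key x) →
                      (orderBy key x y ≡ true) ⊎ (orderBy key y x ≡ true)
      by-trichotomy (tri< kx⊏ky _ _) = inj₁ (dec-true (key x ⊏? key y) kx⊏ky)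
      by-trichotomy (tri≈ _ kx≈ky _) = ⊥-elim (x≢y (injective x y kx≈ky))
      by-trichotomy (tri> _ _ ky⊏kx) = inj₂ (dec-true (key y ⊏? key x) ky⊏kx)

ℕ²-lex : StrictTotalOrder 0ℓ 0ℓ 0ℓ
ℕ²-lex = ×-strictTotalOrder <-strictTotalOrder <-strictTotalOrder

ℕ³-lex : StrictTotalOrder 0ℓ 0ℓ 0ℓ
ℕ³-lex = ×-strictTotalOrder <-strictTotalOrder ℕ²-lex

lex⇒≤ : ∀ {a b u w : ℕ} → ×-Lex _≡_ _<_ _<_ (a , u) (b , w) → a ≤ b
lex⇒≤ (inj₁ a<b)       = <⇒≤ a<b
lex⇒≤ (inj₂ (refl , _)) = ≤-refl

module _ (M : ChainGraph) where
  open ChainGraph M using (adj)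

  EarlierNeighbour : BRel ℕ → ℕ → ℕ → Set
  EarlierNeighbour R x y = adj x y ≡ true × R y x ≡ true

  Is2DegenerateOrder : BRel ℕ → Set
  Is2DegenerateOrder R =
    IsLO M R × (∀ x ys → Unique ys → All (EarlierNeighbour R x) ys → length ys ≤ 2)

  module _ (g : Aut M) where
    open Aut g

    from-injective : ∀ {x y} → from x ≡ from y → x ≡ y
    from-injective {x} {y} fx≡fy = trans (sym (to-from x)) (trans (cong to fx≡fy) (to-from y))

    from-pres : ∀ x y → adj (from x) (from y) ≡ adj x y
    from-pres x y = trans (sym (pres (from x) (from y))) (cong₂ adj (to-from x) (to-from y))

    isLO-act : ∀ {R} → IsLO M R → IsLO M (act M g R)
    isLO-act lo = record
      { irrefl = λ x → IsLO.irrefl lo (from x)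
      ; trans  = λ x y z → IsLO.trans lo (from x) (from y) (from z)
      ; total  = λ x y x≢y → IsLO.total lo (from x) (from y) (x≢y ∘ from-injective)
      }

    2degenerate-act : ∀ R → Is2DegenerateOrder R → Is2DegenerateOrder (act M g R)
    2degenerate-act R (lo , few) = isLO-act lo , λ x ys u earlier → begin
      length ys            ≡⟨ sym (length-map from ys) ⟩
      length (map from ys) ≤⟨ few (from x) (map from ys) (Unique.map⁺ from-injective u)
                                (All.map⁺ (All.map (λ (xy , y≺x) → trans (from-pres x _) xy , y≺x) earlier)) ⟩
      2                    ∎
      where open ≤-Reasoning

  2degenerate-closed : ∀ R → IsLO M R →
    (∀ (F : List ℕ) → ∃ λ R′ → Is2DegenerateOrder R′ × (∀ x y → x ∈ F → y ∈ F → R′ x y ≡ R x y)) →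
    Is2DegenerateOrder R
  2degenerate-closed R lo approx = lo , λ x ys u earlier →
    let (R′ , (_ , few′) , agree) = approx (x ∷ ys)
    in few′ x ys u (All.tabulate λ y∈ys →
         let (xy , y≺x) = All.lookup earlier y∈ys
         in xy , trans (agree _ x (there y∈ys) (here refl)) y≺x)

module DegeneracyOrder (M : ChainGraph) where
  open ChainGraph M using (adj; chain; chain-C1; chain-≤; chain-covers)

  chain-mono : ∀ {m n} → m ≤ n → chain m ⊆ chain n
  chain-mono = go ∘ ≤⇒≤′
    where
    go : ∀ {m n} → m ≤′ n → chain m ⊆ chain n
    go ≤′-refl                    = id
    go {n = suc n} (≤′-step m≤′n) = proj₁ (chain-≤ n) ∘ go m≤′n

  NewAt : ℕ → ℕ → Set
  NewAt zero    v = ⊤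
  NewAt (suc s) v = v ∉ chain s

  entry : ∀ n {v} → v ∈ chain n → ∃ λ s → v ∈ chain s × NewAt s v
  entry zero    v∈ = zero , v∈ , tt
  entry (suc n) {v} v∈ with v ∈? chain n
  ... | yes v∈′ = entry n v∈′
  ... | no  v∉  = suc n , v∈ , v∉

  stage : ℕ → ℕ
  stage v = proj₁ (entry _ (proj₂ (chain-covers v)))

  stage-∈ : ∀ v → v ∈ chain (stage v)
  stage-∈ v = proj₁ (proj₂ (entry _ (proj₂ (chain-covers v))))

  stage-new : ∀ v → NewAt (stage v) v
  stage-new v = proj₂ (proj₂ (entry _ (proj₂ (chain-covers v))))

  orientation : ℕ → BRel ℕ
  orientation zero    = proj₁ (chain-C1 zero)
  orientation (suc n) = proj₁ (proj₂ (chain-≤ n))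

  orientation-acyclic2 : ∀ s → IsAcyclic2Orientation adj (chain s) (orientation s)
  orientation-acyclic2 zero    = proj₂ (chain-C1 zero)
  orientation-acyclic2 (suc n) = proj₁ (proj₂ (proj₂ (chain-≤ n)))

  orientation-closed : ∀ n {x y} → x ∈ chain n → orientation (suc n) x y ≡ true → y ∈ chain n
  orientation-closed n = proj₂ (proj₂ (proj₂ (chain-≤ n))) _ _

  module _ (s : ℕ) where
    open Heights (chain s) (orientation s) public using (successors; ∈-successors⁺)
      renaming (rank to rankAt)

    rankAt-decreasing : ∀ {y z} → z ∈ chain s → orientation s y z ≡ true → rankAt z < rankAt y
    rankAt-decreasing = Heights.rank-decreasing (chain s) (orientation s)
                          (IsAcyclic2Orientation.acyclic (orientation-acyclic2 s))

  key : ℕ → ℕ × ℕ × ℕ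
  key v = stage v , rankAt (stage v) v , v

  degeneracyOrder : BRel ℕ
  degeneracyOrder = orderBy M ℕ³-lex key

  old-before-new : ∀ {n x y} → y ∈ chain n → x ∉ chain n →
                   y ∈ chain (suc n) × orientation (suc n) y x ≢ true
  old-before-new {n} y∈ x∉ = proj₁ (chain-≤ n) y∈ , x∉ ∘ orientation-closed n y∈

  earlier-stage : ∀ {x y} → stage y < stage x → y ∈ chain (stage x) × orientation (stage x) y x ≢ true
  earlier-stage {x} {y} y<x with stage x | stage-new x
  earlier-stage {x} {y} () | zero | _
  ... | suc n | x∉ = old-before-new (chain-mono (≤-pred y<x) (stage-∈ y)) x∉

  same-stage : ∀ {s x y} → x ∈ chain s → rankAt s y ≤ rankAt s x → orientation s y x ≢ true
  same-stage {s} x∈ y≤x yx = <-irrefl refl (<-≤-trans (rankAt-decreasing s x∈ yx) y≤x)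

  successor-of-¬reverse : ∀ {x y} → adj x y ≡ true → y ∈ chain (stage x) →
                          orientation (stage x) y x ≢ true → y ∈ successors (stage x) x
  successor-of-¬reverse {x} xy y∈ ¬yx =
    ∈-successors⁺ (stage x) y∈ (arc-of-¬reverse (orientation-acyclic2 (stage x)) (stage-∈ x) y∈ xy ¬yx)

  earlier-neighbour-is-successor : ∀ {x y} → adj x y ≡ true → degeneracyOrder y x ≡ true →
                                   y ∈ successors (stage x) x
  earlier-neighbour-is-successor {x} {y} xy y≺x with orderBy⇒⊏ M ℕ³-lex key y≺x
  ... | inj₁ y<x = let (y∈ , ¬yx) = earlier-stage y<x in successor-of-¬reverse xy y∈ ¬yx
  ... | inj₂ (stage≡ , rank≤) =
    successor-of-¬reverse xy y∈ (same-stage (stage-∈ x) (subst (λ s → rankAt s y ≤ _) stage≡ (lex⇒≤ rank≤)))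
    where
    y∈ : y ∈ chain (stage x)
    y∈ = subst (λ s → y ∈ chain s) stage≡ (stage-∈ y)

  degeneracyOrder-2degenerate : Is2DegenerateOrder M degeneracyOrder
  degeneracyOrder-2degenerate =
    orderBy-isLO M ℕ³-lex key (λ _ _ key≈ → proj₂ (proj₂ key≈)) ,
    λ x ys u earlier →
      ≤-trans (Unique⇒length-≤ u λ y∈ys → let (xy , y≺x) = All.lookup earlier y∈ys
                                           in earlier-neighbour-is-successor xy y≺x)
              (IsAcyclic2Orientation.outdeg (orientation-acyclic2 (stage x)) x (stage-∈ x))

2degenerate-subflow : ∀ M → IsSubflow M (Is2DegenerateOrder M)
2degenerate-subflow M =
  (λ _ → proj₁) ,
  (degeneracyOrder , degeneracyOrder-2degenerate) ,
  2degenerate-act M ,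
  2degenerate-closed M
  where open DegeneracyOrder M

star : FinGraph
star = record { size = 4 ; adj = centre-leaf ; sym = symmetric ; irrefl = irreflexive }
  where
  centre-leaf : BRel (Fin 4)
  centre-leaf fzero    (fsuc _) = true
  centre-leaf (fsuc _) fzero    = true
  centre-leaf _        _        = false

  symmetric : ∀ x y → centre-leaf x y ≡ centre-leaf y x
  symmetric fzero    fzero    = refl
  symmetric fzero    (fsuc _) = refl
  symmetric (fsuc _) fzero    = refl
  symmetric (fsuc _) (fsuc _) = refl

  irreflexive : ∀ x → centre-leaf x x ≡ false
  irreflexive fzero    = refl
  irreflexive (fsuc _) = refl

star-C1 : InC1 (FinGraph.adj star) (allFin 4)
star-C1 = towards-centre , record
  { onEdges = onEdges ; orients = orients ; outdeg = outdeg ; acyclic = acyclic }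
  where
  towards-centre : BRel (Fin 4)
  towards-centre (fsuc _) fzero = true
  towards-centre _        _     = false

  Arc : Fin 4 → Fin 4 → Set
  Arc x y = towards-centre x y ≡ true

  onEdges : ∀ x y → Arc x y → (x ∈ allFin 4) × (y ∈ allFin 4) × (FinGraph.adj star x y ≡ true)
  onEdges (fsuc _) fzero _ = ∈-allFin _ , ∈-allFin _ , refl

  orients : ∀ x y → x ∈ allFin 4 → y ∈ allFin 4 → FinGraph.adj star x y ≡ true →
            ((towards-centre x y ≡ true) × (towards-centre y x ≡ false)) ⊎
            ((towards-centre x y ≡ false) × (towards-centre y x ≡ true))
  orients fzero    (fsuc _) _ _ _ = inj₂ (refl , refl)
  orients (fsuc _) fzero    _ _ _ = inj₁ (refl , refl)

  outdeg : ∀ x → x ∈ allFin 4 → length (filterᵇ (towards-centre x) (allFin 4)) ≤ 2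
  outdeg fzero    _ = z≤n
  outdeg (fsuc _) _ = s≤s z≤n

  ends-at-centre : ∀ {x y} → TransClosure Arc x y → y ≡ fzero
  ends-at-centre {fsuc _} {fzero} [ _ ] = refl
  ends-at-centre (_ ∷ x⁺y)              = ends-at-centre x⁺y

  centre-is-sink : ∀ {y} → ¬ TransClosure Arc fzero y
  centre-is-sink [ () ]
  centre-is-sink (() ∷ _)

  acyclic : ∀ x → ¬ TransClosure Arc x x
  acyclic x x⁺x with ends-at-centre x⁺x
  ... | refl = centre-is-sink x⁺x

module _ (M : ChainGraph) where
  open ChainGraph M using (adj; irrefl)

  lastKey : ℕ → ℕ → ℕ × ℕ
  lastKey c v = (if does (v ≟ c) then 1 else 0) , v

  putLast : ℕ → BRel ℕ
  putLast c = orderBy M ℕ²-lex (lastKey c)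

  putLast-isLO : ∀ c → IsLO M (putLast c)
  putLast-isLO c = orderBy-isLO M ℕ²-lex (lastKey c) (λ _ _ → proj₂)

  putLast-last : ∀ {c v} → v ≢ c → putLast c v c ≡ true
  putLast-last {c} {v} v≢c = dec-true (lastKey c v ⊏? lastKey c c) (inj₁ 0<1)
    where
    open StrictTotalOrder ℕ²-lex using () renaming (_<?_ to _⊏?_)
    0<1 : proj₁ (lastKey c v) < proj₁ (lastKey c c)
    0<1 rewrite dec-false (v ≟ c) v≢c | dec-true (c ≟ c) refl = s≤s z≤n

  neighbour-≢ : ∀ {x y} → adj x y ≡ true → y ≢ x
  neighbour-≢ {x} xy refl with trans (sym xy) (irrefl x)
  ... | ()

  putLast-¬2degenerate : ∀ {x ys} → Unique ys → All (λ y → adj x y ≡ true) ys → 3 ≤ length ys →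
                         ¬ Is2DegenerateOrder M (putLast x)
  putLast-¬2degenerate {x} {ys} u neighbours 3≤length (_ , few) with
    ≤-trans 3≤length (few x ys u (All.map (λ xy → xy , putLast-last (neighbour-≢ xy)) neighbours))
  ... | s≤s (s≤s ())

  degree-3-vertex : Universal M →
    ∃ λ x → ∃ λ ys → Unique ys × All (λ y → adj x y ≡ true) ys × 3 ≤ length ys
  degree-3-vertex universal with universal star star-C1
  ... | f , f-injective , f-adj , _ =
    f fzero , tabulate (f ∘ fsuc) ,
    Unique.tabulate⁺ (Fin.suc-injective ∘ f-injective) ,
    All.tabulate⁺ (λ i → f-adj fzero (fsuc i)) ,
    ≤-refl

proposition4p9 : (M : ChainGraph) → IsM1 M → LONotMinimal M
proposition4p9 M (universal , _) with degree-3-vertex M universal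
... | x , ys , u , neighbours , 3≤length =
  Is2DegenerateOrder M , 2degenerate-subflow M ,
  putLast M x , putLast-isLO M x , putLast-¬2degenerate M u neighbours 3≤length
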